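{- Let $X\subseteq\mathbf{C}$ be a $\Pi^0_1$ class and $A\subseteq\mathbb{N}$. If $X$ has an $A$ covering, then $X$ has a computable $A$ covering (i.e. one computable with oracle $A$).
   Context: $\mathbf{C}=\{0,1\}^\infty$; $\sqsubseteq$ prefix. $X\in\Pi^0_1$ if there is a computable tree $T\subseteq\{0,1\}^*$ whose infinite paths are exactly the elements of $X$. An $A$ covering of $X$ is a function $f:\mathbb{N}\to\{0,1\}^*$ such that (1) for every $n\in A$, $f(n)$ is a string of length $n$, and (2) for every $S\in X$ there is $n\in A$ with $f(n)\sqsubseteq S$. A computable $A$ covering is such a function computable by an oracle Turing machine with oracle $A$. -}

module Defs where

open import Data.Nat using (ℕ; zero; suc; _+_; _*_; _<_)
open import Data.Bool using (Bool; true; false; if_then_else_)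
open import Data.List using (List; []; _∷_; length; _++_)
open import Data.Fin using (Fin)
open import Data.Vec using (Vec; []; _∷_; lookup)
open import Data.Product using (Σ; ∃; _×_; _,_)
open import Relation.Binary.PropositionalEquality using (_≡_)

Seq : Set
Seq = ℕ → Bool

Str : Set
Str = List Bool

prefix : ℕ → Seq → Str
prefix zero    S = []
prefix (suc n) S = S 0 ∷ prefix n (λ i → S (suc i))

_⊑_ : Str → Seq → Set
σ ⊑ S = σ ≡ prefix (length σ) S

data PR : ℕ → Set where
  zer    : ∀ {n} → PR n
  succ   : PR 1
  proj   : ∀ {n} → Fin n → PR n
  comp   : ∀ {m n} → PR m → Vec (PR n) m → PR n
  prec   : ∀ {n} → PR n → PR (suc (suc n)) → PR (suc n)
  mu     : ∀ {n} → PR (suc n) → PR n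
  oracle : PR 1

bit : Bool → ℕ
bit true  = 1
bit false = 0

mutual
  data Eval (A : ℕ → Bool) : ∀ {n} → PR n → Vec ℕ n → ℕ → Set where
    e-zer    : ∀ {n} {xs : Vec ℕ n} → Eval A zer xs 0
    e-succ   : ∀ {x} → Eval A succ (x ∷ []) (suc x)
    e-proj   : ∀ {n} {i : Fin n} {xs} → Eval A (proj i) xs (lookup xs i)
    e-comp   : ∀ {m n} {f : PR m} {gs : Vec (PR n) m} {xs ys y} →
               EvalVec A gs xs ys → Eval A f ys y → Eval A (comp f gs) xs y
    e-prec0  : ∀ {n} {f : PR n} {g xs y} →
               Eval A f xs y → Eval A (prec f g) (0 ∷ xs) y
    e-precS  : ∀ {n} {f : PR n} {g xs k y z} →
               Eval A (prec f g) (k ∷ xs) y →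
               Eval A g (k ∷ y ∷ xs) z → Eval A (prec f g) (suc k ∷ xs) z
    e-mu     : ∀ {n} {f : PR (suc n)} {xs y} →
               Eval A f (y ∷ xs) 0 →
               (∀ z → z < y → Σ ℕ λ w → Eval A f (z ∷ xs) (suc w)) →
               Eval A (mu f) xs y
    e-oracle : ∀ {x} → Eval A oracle (x ∷ []) (bit (A x))

  data EvalVec (A : ℕ → Bool) {n : ℕ} : ∀ {m} → Vec (PR n) m → Vec ℕ n → Vec ℕ m → Set where
    ev-nil  : ∀ {xs} → EvalVec A [] xs []
    ev-cons : ∀ {m} {g : PR n} {gs : Vec (PR n) m} {xs y ys} →
              Eval A g xs y → EvalVec A gs xs ys → EvalVec A (g ∷ gs) xs (y ∷ ys)

-- bijective coding of binary strings by naturals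
encode : Str → ℕ
encode []          = 0
encode (false ∷ s) = 1 + 2 * encode s
encode (true  ∷ s) = 2 + 2 * encode s

∅ : ℕ → Bool
∅ _ = false

ComputableSet : (Str → Bool) → Set
ComputableSet T = Σ (PR 1) λ p → ∀ σ → Eval ∅ p (encode σ ∷ []) (bit (T σ))

ComputableIn : (ℕ → Bool) → (ℕ → Str) → Set
ComputableIn A f = Σ (PR 1) λ p → ∀ n → Eval A p (n ∷ []) (encode (f n))

IsTree : (Str → Bool) → Set
IsTree T = ∀ σ τ → T (σ ++ τ) ≡ true → T σ ≡ true

IsPath : (Str → Bool) → Seq → Set
IsPath T S = ∀ n → T (prefix n S) ≡ true

Π⁰₁ : (Seq → Set) → Set
Π⁰₁ X = Σ (Str → Bool) λ T →
          IsTree T × ComputableSet T × (∀ S → (X S → IsPath T S) × (IsPath T S → X S))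

IsCovering : (ℕ → Bool) → (Seq → Set) → (ℕ → Str) → Set
IsCovering A X f =
  (∀ n → A n ≡ true → length (f n) ≡ n) ×
  (∀ S → X S → Σ ℕ λ n → A n ≡ true × f n ⊑ S)

-- Cantor space is compact and X is closed in it, so already finitely many
-- of the cylinders [f n] with n ∈ A cover X.  Keeping f on that finite
-- part and filling in the remaining lengths with the all-ones string gives
-- an A covering that is a finite table followed by a computable function,
-- hence computable (even without using the oracle).
module Submission where

open import Defs
open import Level using (0ℓ)
open import Axiom.ExcludedMiddle using (ExcludedMiddle)
open import Axiom.DoubleNegationElimination using (DoubleNegationElimination; em⇒dne)
open import Data.Nat using (ℕ; zero; suc; _+_; _<_; _≤_; z≤n; s≤s; _≟_; _⊔_; _<?_)
open import Data.Nat.Properties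
  using (≤-trans; ≤-refl; <⇒≢; m≤m⊔n; m≤n⊔m; m<1+n⇒m<n∨m≡n; m≤n⇒∃[o]m+o≡n; ≰⇒>; +-identityʳ; +-comm)
open import Data.Bool using (Bool; true; false)
open import Data.List using (_∷_; length; replicate)
open import Data.List.Properties using (length-replicate)
open import Data.Fin using (zero; suc)
open import Data.Vec using (Vec; []; _∷_)
open import Data.Product using (Σ; _×_; _,_; proj₁; proj₂)
open import Data.Sum using (inj₁; inj₂)
open import Data.Empty using (⊥-elim)
open import Relation.Nullary using (Dec; yes; no; ¬_)
open import Relation.Nullary.Decidable using (isNo)
open import Relation.Binary.PropositionalEquality
  using (_≡_; refl; sym; trans; cong; cong₂; subst; module ≡-Reasoning)
open ≡-Reasoning

Agree : ℕ → Seq → Seq → Set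
Agree k S S′ = ∀ i → i < k → S i ≡ S′ i

IsClosed : (Seq → Set) → Set
IsClosed X = ∀ S → (∀ k → Σ Seq λ S′ → X S′ × Agree k S S′) → X S

IsOpen : (Seq → Set) → Set
IsOpen U = ∀ S → U S → Σ ℕ λ k → ∀ S′ → Agree k S S′ → U S′

Agree-trans : ∀ {k S S′ S″} → Agree k S S′ → Agree k S′ S″ → Agree k S S″
Agree-trans p q i i<k = trans (p i i<k) (q i i<k)

Agree⇒prefix≡ : ∀ k {S S′} → Agree k S S′ → prefix k S ≡ prefix k S′
Agree⇒prefix≡ zero    ag = refl
Agree⇒prefix≡ (suc k) ag =
  cong₂ _∷_ (ag 0 (s≤s z≤n)) (Agree⇒prefix≡ k (λ i i<k → ag (suc i) (s≤s i<k)))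

cylinder-open : ∀ σ → IsOpen (σ ⊑_)
cylinder-open σ S σ⊑S = length σ , λ S′ ag → trans σ⊑S (Agree⇒prefix≡ (length σ) ag)

×-open : ∀ {P : Set} {U} → IsOpen U → IsOpen (λ S → P × U S)
×-open U-open S (p , u) = let (k , near) = U-open S u in k , λ S′ ag → p , near S′ ag

Π⁰₁⇒closed : ∀ {X} → Π⁰₁ X → IsClosed X
Π⁰₁⇒closed (T , _ , _ , iff) S near = proj₂ (iff S) λ n →
  let (S′ , xS′ , ag) = near n
  in trans (cong T (Agree⇒prefix≡ n ag)) (proj₁ (iff S′) xS′ n)

_[_≔_] : Seq → ℕ → Bool → Seq
(S [ k ≔ b ]) i with i ≟ k
... | yes _ = b
... | no  _ = S i

[≔]-other : ∀ S k b {i} → i < k → (S [ k ≔ b ]) i ≡ S i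
[≔]-other S k b {i} i<k with i ≟ k
... | yes refl = ⊥-elim (<⇒≢ i<k refl)
... | no  _    = refl

Agree-[≔] : ∀ {k S S′} b → Agree k S S′ → S′ k ≡ b → Agree (suc k) (S [ k ≔ b ]) S′
Agree-[≔] {k} b ag S′k≡b i (s≤s i≤k) with i ≟ k
... | yes refl = sym S′k≡b
... | no  i≢k with m<1+n⇒m<n∨m≡n (s≤s i≤k)
...   | inj₁ i<k = ag i i<k
...   | inj₂ i≡k = ⊥-elim (i≢k i≡k)

module Compactness (em : ExcludedMiddle 0ℓ) {X : Seq → Set} (X-closed : IsClosed X)
                   (U : ℕ → Seq → Set) (U-open : ∀ n → IsOpen (U n)) where

  private
    dne : DoubleNegationElimination 0ℓ
    dne = em⇒dne em

  CoveredBy≤ : ℕ → Seq → Set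
  CoveredBy≤ N S = Σ ℕ λ n → n ≤ N × U n S

  UncoveredNear : ℕ → Seq → ℕ → Set
  UncoveredNear k S N = Σ Seq λ S′ → X S′ × Agree k S S′ × ¬ CoveredBy≤ N S′

  Bad : ℕ → Seq → Set
  Bad k S = ∀ N → UncoveredNear k S N

  CoveredBy≤-mono : ∀ {N M S} → N ≤ M → CoveredBy≤ N S → CoveredBy≤ M S
  CoveredBy≤-mono N≤M (n , n≤N , u) = n , ≤-trans n≤N N≤M , u

  ¬Bad⇒bound : ∀ {k S} → ¬ Bad k S → Σ ℕ λ N → ¬ UncoveredNear k S N
  ¬Bad⇒bound ¬bad = dne λ noBound → ¬bad λ N → dne λ noWitness → noBound (N , noWitness)

  Bad-extend : ∀ {k S} → Bad k S → ¬ Bad (suc k) (S [ k ≔ false ]) → Bad (suc k) (S [ k ≔ true ])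
  Bad-extend {k} {S} bad ¬bad₀ N = bitIsTrue (bad (N ⊔ N₀))
    where
      N₀ : ℕ
      N₀ = proj₁ (¬Bad⇒bound ¬bad₀)
      bitIsTrue : UncoveredNear k S (N ⊔ N₀) → UncoveredNear (suc k) (S [ k ≔ true ]) N
      bitIsTrue (S′ , xS′ , ag , ¬cov) with S′ k in eq
      ... | true  = S′ , xS′ , Agree-[≔] true ag eq , λ c → ¬cov (CoveredBy≤-mono (m≤m⊔n N N₀) c)
      ... | false = ⊥-elim (proj₂ (¬Bad⇒bound ¬bad₀)
                      (S′ , xS′ , Agree-[≔] false ag eq , λ c → ¬cov (CoveredBy≤-mono (m≤n⊔m N N₀) c)))

  -- path k fixes the first k bits of the leftmost infinite path through the bad prefixes.
  path : ℕ → Seq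
  path zero    = λ _ → false
  path (suc k) = path k [ k ≔ isNo (em {Bad (suc k) (path k [ k ≔ false ])}) ]

  limit : Seq
  limit i = path (suc i) i

  path-stable : ∀ {k i} → i < k → path k i ≡ limit i
  path-stable {suc k} {i} i<1+k with m<1+n⇒m<n∨m≡n i<1+k
  ... | inj₁ i<k  = trans ([≔]-other (path k) k _ i<k) (path-stable i<k)
  ... | inj₂ refl = refl

  Bad-step : ∀ {k S} → Bad k S → (d : Dec (Bad (suc k) (S [ k ≔ false ]))) →
             Bad (suc k) (S [ k ≔ isNo d ])
  Bad-step bad (yes bad₀) = bad₀
  Bad-step bad (no ¬bad₀) = Bad-extend bad ¬bad₀

  Bad-path : Bad 0 (path 0) → ∀ k → Bad k (path k)
  Bad-path bad zero    = bad
  Bad-path bad (suc k) = Bad-step (Bad-path bad k) em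

  Bad-limit : Bad 0 (path 0) → ∀ k → Bad k limit
  Bad-limit bad k N =
    let (S′ , xS′ , ag , ¬cov) = Bad-path bad k N
    in S′ , xS′ , Agree-trans (λ i i<k → sym (path-stable i<k)) ag , ¬cov

  ¬everywhereBad : (∀ S → X S → Σ ℕ λ n → U n S) → ∀ S → ¬ (∀ k → Bad k S)
  ¬everywhereBad cover S bad =
    let (n , u)              = cover S (X-closed S λ k → let (S′ , xS′ , ag , _) = bad k 0 in S′ , xS′ , ag)
        (k , U-near)         = U-open n S u
        (S′ , _ , ag , ¬cov) = bad k n
    in ¬cov (n , ≤-refl , U-near S′ ag)

  finiteSubcover : (∀ S → X S → Σ ℕ λ n → U n S) → Σ ℕ λ N → ∀ S → X S → CoveredBy≤ N S
  finiteSubcover cover = dne λ noFinite → ¬everywhereBad cover limit (Bad-limit λ N →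
    dne λ noUncovered → noFinite (N , λ S xS → dne λ ¬cov → noUncovered (S , xS , (λ _ ()) , ¬cov)))

numeral : ∀ {n} → ℕ → PR n
numeral zero    = zer
numeral (suc v) = comp succ (numeral v ∷ [])

numeral-eval : ∀ {A n} {xs : Vec ℕ n} v → Eval A (numeral v) xs v
numeral-eval zero    = e-zer
numeral-eval (suc v) = e-comp (ev-cons (numeral-eval v) ev-nil) e-succ

add : PR 2
add = prec (proj zero) (comp succ (proj (suc zero) ∷ []))

add-eval : ∀ {A} x y → Eval A add (x ∷ y ∷ []) (x + y)
add-eval zero    y = e-prec0 e-proj
add-eval (suc x) y = e-precS (add-eval x y) (e-comp (ev-cons e-proj ev-nil) e-succ)

-- Meant as the step of a primitive recursion, hence the ignored first argument.
prependTrue : PR 2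
prependTrue = comp succ (comp succ (comp add (proj (suc zero) ∷ proj (suc zero) ∷ []) ∷ []) ∷ [])

prependTrue-eval : ∀ {A} k σ → Eval A prependTrue (k ∷ encode σ ∷ []) (encode (true ∷ σ))
prependTrue-eval {A} k σ =
  subst (Eval A prependTrue (k ∷ c ∷ [])) (cong (λ z → 2 + (c + z)) (sym (+-identityʳ c)))
    (e-comp (ev-cons (e-comp (ev-cons (e-comp (ev-cons e-proj (ev-cons e-proj ev-nil)) (add-eval c c))
                                      ev-nil) e-succ) ev-nil) e-succ)
  where
    c : ℕ
    c = encode σ

onesFrom : ℕ → ℕ → Str
onesFrom c m = replicate (m + c) true

onesFrom-computable : ∀ {A} c → ComputableIn A (onesFrom c)
onesFrom-computable {A} c = p , eval
  where
    p : PR 1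
    p = prec (numeral (encode (replicate c true))) prependTrue
    eval : ∀ m → Eval A p (m ∷ []) (encode (onesFrom c m))
    eval zero    = e-prec0 (numeral-eval _)
    eval (suc m) = e-precS (eval m) (prependTrue-eval m (onesFrom c m))

infixr 5 _∷ₛ_
_∷ₛ_ : Str → (ℕ → Str) → ℕ → Str
(σ ∷ₛ g) zero    = σ
(σ ∷ₛ g) (suc n) = g n

∷ₛ-computable : ∀ {A} σ {g} → ComputableIn A g → ComputableIn A (σ ∷ₛ g)
∷ₛ-computable {A} σ {g} (p , p-eval) = q , eval
  where
    q : PR 1
    q = prec (numeral (encode σ)) (comp p (proj zero ∷ []))
    eval : ∀ n → Eval A q (n ∷ []) (encode ((σ ∷ₛ g) n))
    eval zero    = e-prec0 (numeral-eval _)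
    eval (suc n) = e-precS (eval n) (e-comp (ev-cons e-proj ev-nil) (p-eval n))

tableThen : (ℕ → Str) → ℕ → (ℕ → Str) → ℕ → Str
tableThen f zero    d = d
tableThen f (suc K) d = f 0 ∷ₛ tableThen (λ i → f (suc i)) K d

tableThen-computable : ∀ {A d} f K → ComputableIn A d → ComputableIn A (tableThen f K d)
tableThen-computable f zero    d-comp = d-comp
tableThen-computable f (suc K) d-comp = ∷ₛ-computable (f 0) (tableThen-computable (λ i → f (suc i)) K d-comp)

tableThen-< : ∀ f K d {n} → n < K → tableThen f K d n ≡ f n
tableThen-< f (suc K) d {zero}  _         = refl
tableThen-< f (suc K) d {suc n} (s≤s n<K) = tableThen-< (λ i → f (suc i)) K d n<K

tableThen-+ : ∀ f K d m → tableThen f K d (K + m) ≡ d m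
tableThen-+ f zero    d m = refl
tableThen-+ f (suc K) d m = tableThen-+ (λ i → f (suc i)) K d m

truncated-covering : ∀ {A X f} K →
  (∀ n → A n ≡ true → length (f n) ≡ n) →
  (∀ S → X S → Σ ℕ λ n → n < K × A n ≡ true × f n ⊑ S) →
  IsCovering A X (tableThen f K (onesFrom K))
truncated-covering {A} {X} {f} K f-length finiteCover = g-length , g-covers
  where
    g : ℕ → Str
    g = tableThen f K (onesFrom K)

    g-length : ∀ n → A n ≡ true → length (g n) ≡ n
    g-length n n∈A with n <? K
    ... | yes n<K = trans (cong length (tableThen-< f K _ n<K)) (f-length n n∈A)
    ... | no  n≮K with m≤n⇒∃[o]m+o≡n (≰⇒> n≮K)
    ...   | m , refl = begin
      length (g (K + m))  ≡⟨ cong length (tableThen-+ f K (onesFrom K) m) ⟩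
      length (onesFrom K m) ≡⟨ length-replicate (m + K) ⟩
      m + K                 ≡⟨ +-comm m K ⟩
      K + m                 ∎

    g-covers : ∀ S → X S → Σ ℕ λ n → A n ≡ true × g n ⊑ S
    g-covers S xS =
      let (n , n<K , n∈A , fn⊑S) = finiteCover S xS
      in n , n∈A , subst (_⊑ S) (sym (tableThen-< f K _ n<K)) fn⊑S

mainTheorem17 : ExcludedMiddle 0ℓ →
    (X : Seq → Set) (A : ℕ → Bool) → Π⁰₁ X →
    Σ (ℕ → Str) (λ f → IsCovering A X f) →
    Σ (ℕ → Str) (λ f → IsCovering A X f × ComputableIn A f)
mainTheorem17 em X A X∈Π⁰₁ (f , f-length , f-covers) =
  tableThen f K (onesFrom K) ,
  truncated-covering K f-length finiteCover ,
  tableThen-computable f K (onesFrom-computable K)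
  where
    open Compactness em (Π⁰₁⇒closed X∈Π⁰₁) (λ n S → A n ≡ true × f n ⊑ S)
                     (λ n → ×-open (cylinder-open (f n)))
    N K : ℕ
    N = proj₁ (finiteSubcover f-covers)
    K = suc N
    finiteCover : ∀ S → X S → Σ ℕ λ n → n < K × A n ≡ true × f n ⊑ S
    finiteCover S xS = let (n , n≤N , cov) = proj₂ (finiteSubcover f-covers) S xS in n , s≤s n≤N , cov
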